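{- Let $\mathcal{S}=(S,\mathbf{r})$ be a ranking system on a finite set $S$. Then $\mathcal{S}$ is concordant if and only if $\mathcal{S}$ is metrizable.
   Context: A ranking system $\mathcal{S}=(S,\mathbf{r})$, $\mathbf{r}=(r_x)_{x\in S}$, is a finite set $S$ together with, for each $x\in S$, a bijection $r_x: S\setminus\{x\}\to\{1,\dots,|S|-1\}$; $x$ prefers $y$ to $z$ iff $r_x(y)<r_x(z)$. $\mathcal{S}$ is metrizable if there is a metric $\rho$ on $S$ such that for all distinct $x,y,z\in S$, $\rho(x,y)<\rho(x,z)$ iff $r_x(y)<r_x(z)$. Write $xy$ for the 2-set $\{x,y\}$ and $\binom{S}{2}$ for the set of 2-element subsets of $S$. For $x\in S$ let $S_x=\{xy: y\in S\setminus\{x\}\}$ and let $\preccurlyeq_x$ be the linear order on $S_x$ given by $\{x,r_x^{ -1}(1)\}\preccurlyeq_x\{x,r_x^{ -1}(2)\}\preccurlyeq_x\cdots\preccurlyeq_x\{x,r_x^{ -1}(|S|-1)\}$, viewed as a set of ordered pairs. Let $R_{\mathcal{S}}=\bigcup_{x\in S}\preccurlyeq_x$. $\mathcal{S}$ is concordant if $R_{\mathcal{S}}$ is contained in some partial order on $\binom{S}{2}$.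
   Formalization: The metric ρ in the definition of metrizable takes values in the rationals rather than in the reals. -}

module Defs where

open import Data.Nat as ℕ using (ℕ; _∸_)
open import Data.Fin as Fin using (Fin)
open import Data.Fin.Properties using (<-cmp)
open import Data.Product using (Σ; _×_; _,_; ∃-syntax; proj₁; proj₂)
open import Data.Rational as ℚ using (ℚ; 0ℚ)
open import Relation.Binary.PropositionalEquality using (_≡_; _≢_)
open import Relation.Binary.Definitions using (tri<; tri≈; tri>)
open import Relation.Binary.Structures using (IsPartialOrder)
open import Relation.Nullary using (¬_)
open import Function.Bundles using (_⇔_)
open import Data.Empty using (⊥-elim)

-- A finite set S is represented by Fin n (|S| = n).
-- r x y is the rank r_x(y); it is only meaningful for y ≢ x.
-- r x restricted to S \ {x} is a bijection onto {1, …, n-1}.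
record RankingSystem (n : ℕ) : Set where
  field
    r        : Fin n → Fin n → ℕ
    r-range  : ∀ x y → y ≢ x → 1 ℕ.≤ r x y × r x y ℕ.≤ n ∸ 1
    r-inj    : ∀ x y z → y ≢ x → z ≢ x → r x y ≡ r x z → y ≡ z
    r-surj   : ∀ x k → 1 ℕ.≤ k → k ℕ.≤ n ∸ 1 → ∃[ y ] (y ≢ x × r x y ≡ k)

open RankingSystem public

Prefers : ∀ {n} → RankingSystem n → Fin n → Fin n → Fin n → Set
Prefers 𝒮 x y z = r 𝒮 x y ℕ.< r 𝒮 x z

record IsMetric {n : ℕ} (ρ : Fin n → Fin n → ℚ) : Set where
  field
    nonneg   : ∀ x y → 0ℚ ℚ.≤ ρ x y
    zero⇔eq  : ∀ x y → ρ x y ≡ 0ℚ ⇔ x ≡ y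
    symm     : ∀ x y → ρ x y ≡ ρ y x
    triangle : ∀ x y z → ρ x z ℚ.≤ ρ x y ℚ.+ ρ y z

Metrizable : ∀ {n} → RankingSystem n → Set
Metrizable {n} 𝒮 =
  Σ (Fin n → Fin n → ℚ) λ ρ → IsMetric ρ ×
    (∀ x y z → x ≢ y → x ≢ z → y ≢ z →
       (ρ x y ℚ.< ρ x z ⇔ Prefers 𝒮 x y z))

-- 2-element subsets of Fin n, in normal form {a, b} with a < b
Pair : ℕ → Set
Pair n = Σ (Fin n × Fin n) λ p → proj₁ p Fin.< proj₂ p

pair : ∀ {n} (x y : Fin n) → x ≢ y → Pair n
pair x y x≢y with <-cmp x y
... | tri< x<y _ _ = (x , y) , x<y
... | tri≈ _ x≡y _ = ⊥-elim (x≢y x≡y)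
... | tri> _ _ y<x = (y , x) , y<x

-- R_𝒮 = ⋃_x ≼_x : (xy, xz) ∈ R_𝒮 iff r_x(y) ≤ r_x(z) for some x, y ≠ x, z ≠ x
data R {n} (𝒮 : RankingSystem n) : Pair n → Pair n → Set where
  R-intro : ∀ x y z (y≢x : y ≢ x) (z≢x : z ≢ x) →
            r 𝒮 x y ℕ.≤ r 𝒮 x z →
            R 𝒮 (pair x y (λ e → y≢x (Relation.Binary.PropositionalEquality.sym e)))
                (pair x z (λ e → z≢x (Relation.Binary.PropositionalEquality.sym e)))

Concordant : ∀ {n} → RankingSystem n → Set₁
Concordant {n} 𝒮 =
  Σ (Pair n → Pair n → Set) λ P → IsPartialOrder _≡_ P ×
    (∀ p q → R 𝒮 p q → P p q)

-- A metric ρ ranks correctly iff ρ(xy) < ρ(xz) whenever x prefers y to z, so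
-- ordering 2-sets by their distance extends R_𝒮: metrizable implies concordant.
-- Conversely, the strict part of R_𝒮 is decidable and, lying inside a partial
-- order, acyclic; the length of the longest chain ending in a 2-set is then a
-- strictly monotone level function bounded by the number B of 2-sets. Setting
-- ρ(xy) = B + 1 + level(xy) for x ≠ y ranks correctly, and since all nonzero
-- distances lie in [B + 1, 2B + 1] the triangle inequality holds automatically.
module Submission where

open import Defs
open import Data.Nat using (ℕ)
open import Function.Bundles using (_⇔_)

open import Data.Empty using (⊥-elim)
open import Data.Fin as Fin using (Fin; zero; suc)
open import Data.Fin.Properties using (_≟_; <-cmp; <-asym; <-irrelevant; any?; pigeonhole)
open import Data.Integer as ℤ using (+_; +≤+; +<+)
import Data.Integer.Properties as ℤ
open import Data.List using (List; []; [_]; length; map; filter; concatMap; cartesianProduct; allFin; lookup)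
open import Data.List.Extrema.Nat using (max; argmax-sel; xs≤max)
open import Data.List.Membership.Propositional using (_∈_)
open import Data.List.Membership.Propositional.Properties
  using (∈-map⁺; ∈-map⁻; ∈-filter⁺; ∈-filter⁻; ∈-concatMap⁺; ∈-cartesianProduct⁺; ∈-allFin)
import Data.List.Relation.Unary.All as All
open import Data.List.Relation.Unary.Any as Any using (here)
open import Data.List.Relation.Unary.Any.Properties using (lookup-index)
open import Data.Nat as ℕ using (zero; suc; _+_; _≤_; _<_; z≤n; s≤s)
open import Data.Nat.Properties as ℕ
  using (≤-refl; ≤-trans; <⇒≤; m≤m+n; n≤1+n; +-monoʳ-≤; +-monoʳ-<; +-mono-≤; ≤∧≢⇒<; ≮⇒≥; module ≤-Reasoning)
open import Data.Product using (Σ; _×_; _,_; proj₂; ∃-syntax)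
open import Data.Product.Properties using (≡-dec)
open import Data.Rational as ℚ using (ℚ; *≤*; *<*)
open import Data.Rational.Literals using (fromℤ)
import Data.Rational.Properties as ℚ
import Data.Rational.Unnormalised as ℚᵘ
import Data.Rational.Unnormalised.Properties as ℚᵘ
open import Data.Sum using (inj₁; inj₂)
open import Function.Base using (_∘_; _on_; const)
open import Function.Bundles using (mk⇔; Equivalence)
open import Level using (0ℓ)
open import Relation.Binary.Core using (Rel)
open import Relation.Binary.Definitions using (DecidableEquality; Decidable; tri<; tri≈; tri>)
open import Relation.Binary.PropositionalEquality
  using (_≡_; _≢_; refl; sym; trans; cong; subst; subst₂; isEquivalence; ≢-sym; module ≡-Reasoning)
open import Relation.Binary.Structures using (IsStrictPartialOrder)
import Relation.Binary.Construct.NonStrictToStrict as NonStrictToStrict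
import Relation.Binary.Construct.StrictToNonStrict as StrictToNonStrict
open import Relation.Nullary using (Dec; yes; no)
open import Relation.Nullary.Decidable using (_×-dec_; map′)

ℕ→ℚ : ℕ → ℚ
ℕ→ℚ k = fromℤ (+ k)

ℕ→ℚ-mono-≤ : ∀ {a b} → a ≤ b → ℕ→ℚ a ℚ.≤ ℕ→ℚ b
ℕ→ℚ-mono-≤ a≤b = *≤* (subst₂ ℤ._≤_ (sym (ℤ.*-identityʳ _)) (sym (ℤ.*-identityʳ _)) (+≤+ a≤b))

ℕ→ℚ-mono-< : ∀ {a b} → a < b → ℕ→ℚ a ℚ.< ℕ→ℚ b
ℕ→ℚ-mono-< a<b = *<* (subst₂ ℤ._<_ (sym (ℤ.*-identityʳ _)) (sym (ℤ.*-identityʳ _)) (+<+ a<b))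

ℕ→ℚ-cancel-< : ∀ {a b} → ℕ→ℚ a ℚ.< ℕ→ℚ b → a < b
ℕ→ℚ-cancel-< (*<* a<b) = ℤ.drop‿+<+ (subst₂ ℤ._<_ (ℤ.*-identityʳ _) (ℤ.*-identityʳ _) a<b)

ℕ→ℚ-injective : ∀ {a b} → ℕ→ℚ a ≡ ℕ→ℚ b → a ≡ b
ℕ→ℚ-injective = ℤ.+-injective ∘ cong ℚ.ℚ.numerator

ℕ→ℚ-homo-+ : ∀ a b → ℕ→ℚ (a + b) ≡ ℕ→ℚ a ℚ.+ ℕ→ℚ b
ℕ→ℚ-homo-+ a b = ℚ.toℚᵘ-injective (ℚᵘ.≃-sym (ℚᵘ.≃-trans (ℚ.toℚᵘ-homo-+ (ℕ→ℚ a) (ℕ→ℚ b)) (ℚᵘ.*≡* numerators)))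
  where
  numerators : (+ a ℤ.* + 1 ℤ.+ + b ℤ.* + 1) ℤ.* + 1 ≡ + (a + b) ℤ.* + 1
  numerators rewrite ℤ.*-identityʳ (+ a) | ℤ.*-identityʳ (+ b) | ℤ.*-identityʳ (+ a ℤ.+ + b) = ℤ.pos-+ a b

on-isStrictPartialOrder : ∀ {a b ℓ} {A : Set a} {B : Set b} {_<_ : Rel B ℓ} (f : A → B) →
                          IsStrictPartialOrder _≡_ _<_ → IsStrictPartialOrder _≡_ (_<_ on f)
on-isStrictPartialOrder f spo = record
  { isEquivalence = isEquivalence
  ; irrefl        = λ { refl → IsStrictPartialOrder.irrefl spo refl }
  ; trans         = IsStrictPartialOrder.trans spo
  ; <-resp-≈      = (λ { refl fx<fy → fx<fy }) , (λ { refl fy<fx → fy<fx })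
  }

reflect-< : ∀ {a b c d} → a ≢ b → (a < b → c < d) → (b < a → d < c) → c < d → a < b
reflect-< {a} {b} a≢b mono mono′ c<d with ℕ.<-cmp a b
... | tri< a<b _ _ = a<b
... | tri≈ _ a≡b _ = ⊥-elim (a≢b a≡b)
... | tri> _ _ b<a = ⊥-elim (ℕ.<-asym c<d (mono′ b<a))

_≟ᴾ_ : ∀ {n} → DecidableEquality (Pair n)
_≟ᴾ_ = ≡-dec (≡-dec _≟_ _≟_) (λ a<b a<b′ → yes (<-irrelevant a<b a<b′))

pair-irrelevant : ∀ {n} (x y : Fin n) (p q : x ≢ y) → pair x y p ≡ pair x y q
pair-irrelevant x y p q with <-cmp x y
... | tri< _ _ _   = refl
... | tri≈ _ x≡y _ = ⊥-elim (p x≡y)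
... | tri> _ _ _   = refl

pair-comm : ∀ {n} (x y : Fin n) (p : x ≢ y) (q : y ≢ x) → pair x y p ≡ pair y x q
pair-comm x y p q with <-cmp x y | <-cmp y x
... | tri< x<y _ _ | tri> _ _ x<y′ = cong ((x , y) ,_) (<-irrelevant x<y x<y′)
... | tri> _ _ y<x | tri< y<x′ _ _ = cong ((y , x) ,_) (<-irrelevant y<x y<x′)
... | tri< x<y _ _ | tri< y<x _ _  = ⊥-elim (<-asym x<y y<x)
... | tri> _ _ y<x | tri> _ _ x<y  = ⊥-elim (<-asym x<y y<x)
... | tri≈ _ x≡y _ | _             = ⊥-elim (p x≡y)
... | _            | tri≈ _ y≡x _  = ⊥-elim (q y≡x)

pair-injectiveʳ : ∀ {n} (x y z : Fin n) (p : x ≢ y) (q : x ≢ z) → pair x y p ≡ pair x z q → y ≡ z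
pair-injectiveʳ x y z p q eq with <-cmp x y | <-cmp x z | eq
... | tri< _ _ _   | tri< _ _ _   | refl = refl
... | tri< _ _ _   | tri> _ _ _   | refl = refl
... | tri> _ _ _   | tri< _ _ _   | refl = refl
... | tri> _ _ _   | tri> _ _ _   | refl = refl
... | tri≈ _ x≡y _ | _            | _    = ⊥-elim (p x≡y)
... | _            | tri≈ _ x≡z _ | _    = ⊥-elim (q x≡z)

onPair : ∀ {n} {A : Set} → (Fin n → Fin n → A) → Pair n → A
onPair f ((a , b) , _) = f a b

onPair-pair : ∀ {n} {A : Set} {f : Fin n → Fin n → A} → (∀ x y → f x y ≡ f y x) →
              ∀ x y (p : x ≢ y) → onPair f (pair x y p) ≡ f x y
onPair-pair f-sym x y p with <-cmp x y
... | tri< _ _ _   = refl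
... | tri≈ _ x≡y _ = ⊥-elim (p x≡y)
... | tri> _ _ _   = f-sym y x

pairsAt : ∀ {n} → Fin n × Fin n → List (Pair n)
pairsAt (a , b) with a Fin.<? b
... | yes a<b = [ (a , b) , a<b ]
... | no _    = []

allPairs : ∀ n → List (Pair n)
allPairs n = concatMap pairsAt (cartesianProduct (allFin n) (allFin n))

∈-allPairs : ∀ {n} (p : Pair n) → p ∈ allPairs n
∈-allPairs p@((a , b) , a<b) =
  ∈-concatMap⁺ pairsAt (Any.map (λ { refl → ∈-pairsAt }) (∈-cartesianProduct⁺ (∈-allFin a) (∈-allFin b)))
  where
  ∈-pairsAt : p ∈ pairsAt (a , b)
  ∈-pairsAt with a Fin.<? b
  ... | yes a<b′ = here (cong ((a , b) ,_) (<-irrelevant a<b a<b′))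
  ... | no a≮b   = ⊥-elim (a≮b a<b)

module LongestChain {V : Set} (vs : List V) (vs-complete : ∀ v → v ∈ vs)
                    {_⋖_ : Rel V 0ℓ} (_⋖?_ : Decidable _⋖_) where

  data Chain : ℕ → V → Set where
    start : ∀ v → Chain 0 v
    _▸_ : ∀ {k u v} → Chain k u → u ⋖ v → Chain (suc k) v

  -- vertices are numbered backwards: vertex c zero is the end of c
  vertex : ∀ {k v} → Chain k v → Fin (suc k) → V
  vertex {v = v} _ zero    = v
  vertex (c ▸ _)   (suc i) = vertex c i

  height : ℕ → V → ℕ
  height zero    v = 0
  height (suc k) v = max 0 (map (suc ∘ height k) (filter (_⋖? v) vs))

  height-suc-≥ : ∀ {k u v} → u ⋖ v → suc (height k u) ≤ height (suc k) v
  height-suc-≥ {k} {u} {v} u⋖v =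
    All.lookup (xs≤max 0 _) (∈-map⁺ (suc ∘ height k) (∈-filter⁺ (_⋖? v) (vs-complete u) u⋖v))

  chain-of-height : ∀ k v → Chain (height k v) v
  chain-of-height zero    v = start v
  chain-of-height (suc k) v with argmax-sel (λ m → m) 0 (map (suc ∘ height k) (filter (_⋖? v) vs))
  ... | inj₁ h≡0 = subst (λ m → Chain m v) (sym h≡0) (start v)
  ... | inj₂ h∈  with u , u∈ , h≡ ← ∈-map⁻ (suc ∘ height k) h∈ =
    subst (λ m → Chain m v) (sym h≡) (chain-of-height k u ▸ proj₂ (∈-filter⁻ (_⋖? v) {xs = vs} u∈))

  chain⇒≤height : ∀ {m k v} → Chain m v → m ≤ k → m ≤ height k v
  chain⇒≤height               (start _) _         = z≤n
  chain⇒≤height {k = suc k} (c ▸ u⋖v) (s≤s m≤k) =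
    ≤-trans (s≤s (chain⇒≤height c m≤k)) (height-suc-≥ {k} u⋖v)

  locate : V → Fin (length vs)
  locate v = Any.index (vs-complete v)

  locate-injective : ∀ {u v} → locate u ≡ locate v → u ≡ v
  locate-injective {u} {v} eq =
    trans (lookup-index (vs-complete u)) (trans (cong (lookup vs) eq) (sym (lookup-index (vs-complete v))))

  module Levels {ℓ} {_≺_ : Rel V ℓ} (≺-spo : IsStrictPartialOrder _≡_ _≺_) (⋖⇒≺ : ∀ {u v} → u ⋖ v → u ≺ v) where
    open IsStrictPartialOrder ≺-spo using () renaming (irrefl to ≺-irrefl; trans to ≺-trans)

    vertex-below-end : ∀ {k v} (c : Chain k v) (i : Fin k) → vertex c (suc i) ≺ v
    vertex-below-end (c ▸ u⋖v) zero    = ⋖⇒≺ u⋖v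
    vertex-below-end (c ▸ u⋖v) (suc i) = ≺-trans (vertex-below-end c i) (⋖⇒≺ u⋖v)

    vertices-distinct : ∀ {k v} (c : Chain k v) {i j} → i Fin.< j → vertex c i ≢ vertex c j
    vertices-distinct c       {zero}  {suc j} _         eq = ≺-irrefl (sym eq) (vertex-below-end c j)
    vertices-distinct (c ▸ _) {suc i} {suc j} (s≤s i<j) eq = vertices-distinct c i<j eq

    chain-length< : ∀ {k v} → Chain k v → k < length vs
    chain-length< {k} c with k ℕ.<? length vs
    ... | yes k<B = k<B
    ... | no k≮B with i , j , i<j , eq ← pigeonhole (s≤s (≮⇒≥ k≮B)) (locate ∘ vertex c) =
      ⊥-elim (vertices-distinct c i<j (locate-injective eq))

    level : V → ℕ
    level = height (length vs)

    level<length : ∀ v → level v < length vs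
    level<length v = chain-length< (chain-of-height (length vs) v)

    level-strictMono : ∀ {u v} → u ⋖ v → level u < level v
    level-strictMono {u} u⋖v = chain⇒≤height c (<⇒≤ (chain-length< c))
      where c = chain-of-height (length vs) u ▸ u⋖v

module PairDistance {n} (w : Pair n → ℕ) (c : ℕ) (w≤c : ∀ p → w p ≤ c) where

  distance : Fin n → Fin n → ℕ
  distance x y with x ≟ y
  ... | yes _   = 0
  ... | no x≢y = suc (c + w (pair x y x≢y))

  distance-≢ : ∀ {x y} (x≢y : x ≢ y) → distance x y ≡ suc (c + w (pair x y x≢y))
  distance-≢ {x} {y} x≢y with x ≟ y
  ... | yes x≡y  = ⊥-elim (x≢y x≡y)
  ... | no x≢y′ = cong (λ p → suc (c + w p)) (pair-irrelevant x y x≢y′ x≢y)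

  distance-refl : ∀ x → distance x x ≡ 0
  distance-refl x with x ≟ x
  ... | yes _   = refl
  ... | no x≢x = ⊥-elim (x≢x refl)

  distance≡0⇔≡ : ∀ x y → distance x y ≡ 0 ⇔ x ≡ y
  distance≡0⇔≡ x y with x ≟ y
  ... | yes x≡y = mk⇔ (const x≡y) (const refl)
  ... | no x≢y  = mk⇔ (λ ()) (⊥-elim ∘ x≢y)

  distance-sym : ∀ x y → distance x y ≡ distance y x
  distance-sym x y with x ≟ y
  ... | yes refl = sym (distance-refl x)
  ... | no x≢y   = begin
    suc (c + w (pair x y x≢y))        ≡⟨ cong (λ p → suc (c + w p)) (pair-comm x y x≢y (≢-sym x≢y)) ⟩
    suc (c + w (pair y x (≢-sym x≢y))) ≡⟨ distance-≢ (≢-sym x≢y) ⟨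
    distance y x                      ∎
    where open ≡-Reasoning

  distance-≥ : ∀ {x y} → x ≢ y → suc c ≤ distance x y
  distance-≥ {x} {y} x≢y with x ≟ y
  ... | yes x≡y = ⊥-elim (x≢y x≡y)
  ... | no _    = s≤s (m≤m+n c _)

  distance-≤ : ∀ x y → distance x y ≤ suc (c + c)
  distance-≤ x y with x ≟ y
  ... | yes _ = z≤n
  ... | no _  = s≤s (+-monoʳ-≤ c (w≤c _))

  distance-triangle : ∀ x y z → distance x z ≤ distance x y + distance y z
  distance-triangle x y z = by-cases (x ≟ y) (y ≟ z)
    where
    by-cases : Dec (x ≡ y) → Dec (y ≡ z) → distance x z ≤ distance x y + distance y z
    by-cases (yes refl) _ rewrite distance-refl x = ≤-refl
    by-cases _ (yes refl) rewrite distance-refl y = m≤m+n _ 0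
    by-cases (no x≢y) (no y≢z) = begin
      distance x z                ≤⟨ distance-≤ x z ⟩
      suc (c + c)                 ≤⟨ s≤s (+-monoʳ-≤ c (n≤1+n c)) ⟩
      suc c + suc c               ≤⟨ +-mono-≤ (distance-≥ x≢y) (distance-≥ y≢z) ⟩
      distance x y + distance y z ∎
      where open ≤-Reasoning

  distance-mono : ∀ {x y z} (x≢y : x ≢ y) (x≢z : x ≢ z) →
                  w (pair x y x≢y) < w (pair x z x≢z) → distance x y < distance x z
  distance-mono x≢y x≢z w< =
    subst₂ _<_ (sym (distance-≢ x≢y)) (sym (distance-≢ x≢z)) (s≤s (+-monoʳ-< c w<))

module _ {n} (𝒮 : RankingSystem n) where

  metrizable-fromℕ : (d : Fin n → Fin n → ℕ) →
                     (∀ x y → d x y ≡ 0 ⇔ x ≡ y) → (∀ x y → d x y ≡ d y x) →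
                     (∀ x y z → d x z ≤ d x y + d y z) →
                     (∀ x y z → x ≢ y → x ≢ z → y ≢ z → (d x y < d x z ⇔ Prefers 𝒮 x y z)) →
                     Metrizable 𝒮
  metrizable-fromℕ d d≡0⇔≡ d-sym d-triangle d-ranks = ρ , isMetric , ρ-ranks
    where
    ρ : Fin n → Fin n → ℚ
    ρ x y = ℕ→ℚ (d x y)

    isMetric : IsMetric ρ
    isMetric = record
      { nonneg   = λ x y → ℕ→ℚ-mono-≤ z≤n
      ; zero⇔eq  = λ x y → mk⇔ (Equivalence.to (d≡0⇔≡ x y) ∘ ℕ→ℚ-injective)
                               (cong ℕ→ℚ ∘ Equivalence.from (d≡0⇔≡ x y))
      ; symm     = λ x y → cong ℕ→ℚ (d-sym x y)
      ; triangle = λ x y z → subst (ρ x z ℚ.≤_) (ℕ→ℚ-homo-+ (d x y) (d y z)) (ℕ→ℚ-mono-≤ (d-triangle x y z))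
      }

    ρ-ranks : ∀ x y z → x ≢ y → x ≢ z → y ≢ z → (ρ x y ℚ.< ρ x z ⇔ Prefers 𝒮 x y z)
    ρ-ranks x y z x≢y x≢z y≢z = mk⇔ (to ∘ ℕ→ℚ-cancel-<) (ℕ→ℚ-mono-< ∘ from)
      where open Equivalence (d-ranks x y z x≢y x≢z y≢z)

  StepAt : Fin n → Fin n → Fin n → Pair n → Pair n → Set
  StepAt x y z p q = Σ (y ≢ x) λ y≢x → Σ (z ≢ x) λ z≢x →
    p ≡ pair x y (≢-sym y≢x) × q ≡ pair x z (≢-sym z≢x) × Prefers 𝒮 x y z

  Step : Pair n → Pair n → Set
  Step p q = ∃[ x ] ∃[ y ] ∃[ z ] StepAt x y z p q

  stepAt? : ∀ x y z p q → Dec (StepAt x y z p q)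
  stepAt? x y z p q with y ≟ x | z ≟ x
  ... | yes y≡x | _       = no λ (y≢x , _) → y≢x y≡x
  ... | no _    | yes z≡x = no λ (_ , z≢x , _) → z≢x z≡x
  ... | no y≢x  | no z≢x  =
    map′ (λ (p≡ , q≡ , y<z) → y≢x , z≢x , p≡ , q≡ , y<z)
         (λ (_ , _ , p≡ , q≡ , y<z) → trans p≡ (pair-irrelevant x y _ _) , trans q≡ (pair-irrelevant x z _ _) , y<z)
         (p ≟ᴾ pair x y (≢-sym y≢x) ×-dec q ≟ᴾ pair x z (≢-sym z≢x) ×-dec r 𝒮 x y ℕ.<? r 𝒮 x z)

  step? : Decidable Step
  step? p q = any? λ x → any? λ y → any? λ z → stepAt? x y z p q

  step⇒R : ∀ {p q} → Step p q → R 𝒮 p q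
  step⇒R (x , y , z , y≢x , z≢x , refl , refl , y<z) = R-intro x y z y≢x z≢x (<⇒≤ y<z)

  step⇒≢ : ∀ {p q} → Step p q → p ≢ q
  step⇒≢ (x , y , z , y≢x , z≢x , refl , refl , y<z) eq
    with refl ← pair-injectiveʳ x y z (≢-sym y≢x) (≢-sym z≢x) eq = ℕ.<-irrefl refl y<z

  concordant⇒metrizable : Concordant 𝒮 → Metrizable 𝒮
  concordant⇒metrizable (_≼_ , ≼-po , R⇒≼) =
    metrizable-fromℕ distance distance≡0⇔≡ distance-sym distance-triangle ranks
    where
    open NonStrictToStrict _≡_ _≼_ using () renaming (_<_ to _≺_; <-isStrictPartialOrder to ≺-isStrictPartialOrder)

    step⇒≺ : ∀ {p q} → Step p q → p ≺ q
    step⇒≺ s = R⇒≼ _ _ (step⇒R s) , step⇒≢ s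

    open LongestChain (allPairs n) ∈-allPairs step?
    open Levels (≺-isStrictPartialOrder ≼-po) step⇒≺
    open PairDistance level (length (allPairs n)) (<⇒≤ ∘ level<length)

    prefers⇒closer : ∀ x y z → x ≢ y → x ≢ z → Prefers 𝒮 x y z → distance x y < distance x z
    prefers⇒closer x y z x≢y x≢z y<z = distance-mono _ _
      (level-strictMono (x , y , z , ≢-sym x≢y , ≢-sym x≢z , refl , refl , y<z))

    ranks : ∀ x y z → x ≢ y → x ≢ z → y ≢ z → (distance x y < distance x z ⇔ Prefers 𝒮 x y z)
    ranks x y z x≢y x≢z y≢z = mk⇔
      (reflect-< (y≢z ∘ r-inj 𝒮 x y z (≢-sym x≢y) (≢-sym x≢z))
                 (prefers⇒closer x y z x≢y x≢z) (prefers⇒closer x z y x≢z x≢y))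
      (prefers⇒closer x y z x≢y x≢z)

  metrizable⇒concordant : Metrizable 𝒮 → Concordant 𝒮
  metrizable⇒concordant (ρ , ρ-metric , ρ-ranks) =
    _≼_ , isPartialOrder (on-isStrictPartialOrder (onPair ρ) ℚ.<-isStrictPartialOrder) , R⇒≼
    where
    open StrictToNonStrict _≡_ (ℚ._<_ on onPair ρ) using (isPartialOrder) renaming (_≤_ to _≼_)

    ρ-pair : ∀ x y p → onPair ρ (pair x y p) ≡ ρ x y
    ρ-pair = onPair-pair (IsMetric.symm ρ-metric)

    R⇒≼ : ∀ p q → R 𝒮 p q → p ≼ q
    R⇒≼ _ _ (R-intro x y z y≢x z≢x ry≤rz) with y ≟ z
    ... | yes refl = inj₂ (pair-irrelevant x y _ _)
    ... | no y≢z   = inj₁ (subst₂ ℚ._<_ (sym (ρ-pair x y _)) (sym (ρ-pair x z _))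
      (Equivalence.from (ρ-ranks x y z (≢-sym y≢x) (≢-sym z≢x) y≢z)
                        (≤∧≢⇒< ry≤rz (y≢z ∘ r-inj 𝒮 x y z y≢x z≢x))))

lemma5p5 : ∀ (n : ℕ) (𝒮 : RankingSystem n) → Concordant 𝒮 ⇔ Metrizable 𝒮
lemma5p5 n 𝒮 = mk⇔ (concordant⇒metrizable 𝒮) (metrizable⇒concordant 𝒮)
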